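{- Let $G$ be a finite simple graph. Then $$\varphi^{(1)}(G)\leq\varphi^{(2)}(G)\leq\cdots\leq\varphi^{(k)}(G)\leq\cdots\leq\varphi(G)\leq\omega(G)\leq\chi(G),$$ i.e. $\varphi^{(k-1)}(G)\leq\varphi^{(k)}(G)\leq\varphi(G)$ for every natural $k$ (with $k\geq2$ in the first inequality), and $\varphi(G)\leq\omega(G)\leq\chi(G)$.
   Context: Let $G$ have $n$ vertices and let $d(v)$ denote the degree of $v$. For nonempty $W\subseteq V(G)$ and natural $k$, $D_k(W)=\left(\frac{1}{|W|}\sum_{v\in W}d^k(v)\right)^{1/k}$. $W$ is a small set if $d(v)\leq n-|W|$ for all $v\in W$; $W$ is a $\delta_k$-small set if $D_k(W)\leq n-|W|$. $\varphi(G)$ is the smallest natural number $r$ such that $V(G)$ is a disjoint union of $r$ small sets; $\varphi^{(k)}(G)$ is the smallest natural number $r$ such that $V(G)$ is a disjoint union of $r$ $\delta_k$-small sets. $\omega(G)$ is the clique number and $\chi(G)$ the chromatic number. -}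

module Defs where

open import Data.Nat using (ℕ; zero; suc; _+_; _*_; _∸_; _^_; _≤_)
open import Data.Fin using (Fin; _≟_)
open import Data.Bool using (Bool; true; false; if_then_else_)
open import Data.List using (List; map; allFin)
open import Data.Nat.ListAction using (sum)
open import Data.Product using (Σ; _×_; ∃; ∃-syntax)
open import Function.Definitions using (Surjective; Injective)
open import Relation.Binary.PropositionalEquality using (_≡_; _≢_)
open import Relation.Nullary using (does)

record Graph (n : ℕ) : Set where
  field
    adj   : Fin n → Fin n → Bool
    sym   : ∀ u v → adj u v ≡ adj v u
    irrfl : ∀ v → adj v v ≡ false
open Graph public

Σᵥ : ∀ {n} → (Fin n → ℕ) → ℕ
Σᵥ {n} f = sum (map f (allFin n))

deg : ∀ {n} → Graph n → Fin n → ℕ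
deg G v = Σᵥ (λ u → if adj G v u then 1 else 0)

-- A partition of V(G) into r classes is given by a surjective class map
-- c : V → Fin r; the classes W_i = c⁻¹(i) are then disjoint, nonempty
-- and cover V.
Partition : ℕ → ℕ → Set
Partition n r = Σ (Fin n → Fin r) (λ c → Surjective _≡_ _≡_ c)

inClass : ∀ {n r} → (Fin n → Fin r) → Fin r → Fin n → Bool
inClass c i v = does (c v ≟ i)

classSize : ∀ {n r} → (Fin n → Fin r) → Fin r → ℕ
classSize c i = Σᵥ (λ v → if inClass c i v then 1 else 0)

classDegPow : ∀ {n r} → Graph n → ℕ → (Fin n → Fin r) → Fin r → ℕ
classDegPow G k c i = Σᵥ (λ v → if inClass c i v then deg G v ^ k else 0)

IsSmallClass : ∀ {n r} → Graph n → (Fin n → Fin r) → Fin r → Set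
IsSmallClass {n} G c i = ∀ v → c v ≡ i → deg G v ≤ n ∸ classSize c i

-- W_i is δ_k-small: D_k(W_i) ≤ n - |W_i|, i.e. (raising to the k-th power
-- and multiplying by |W_i| > 0)  Σ_{v∈W_i} d(v)^k ≤ |W_i| · (n - |W_i|)^k
IsDeltaSmallClass : ∀ {n r} → Graph n → ℕ → (Fin n → Fin r) → Fin r → Set
IsDeltaSmallClass {n} G k c i =
  classDegPow G k c i ≤ classSize c i * (n ∸ classSize c i) ^ k

SmallPartition : ∀ {n} → Graph n → ℕ → Set
SmallPartition {n} G r =
  Σ (Partition n r) (λ p → ∀ i → IsSmallClass G (Σ.proj₁ p) i)

DeltaSmallPartition : ∀ {n} → Graph n → ℕ → ℕ → Set
DeltaSmallPartition {n} G k r =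
  Σ (Partition n r) (λ p → ∀ i → IsDeltaSmallClass G k (Σ.proj₁ p) i)

IsLeast : (ℕ → Set) → ℕ → Set
IsLeast P r = P r × (∀ s → P s → r ≤ s)

IsGreatest : (ℕ → Set) → ℕ → Set
IsGreatest P r = P r × (∀ s → P s → s ≤ r)

IsPhi : ∀ {n} → Graph n → ℕ → Set
IsPhi G = IsLeast (SmallPartition G)

IsPhiK : ∀ {n} → Graph n → ℕ → ℕ → Set
IsPhiK G k = IsLeast (DeltaSmallPartition G k)

HasClique : ∀ {n} → Graph n → ℕ → Set
HasClique {n} G m =
  Σ (Fin m → Fin n) (λ f → Injective _≡_ _≡_ f ×
     (∀ i j → i ≢ j → adj G (f i) (f j) ≡ true))

IsCliqueNumber : ∀ {n} → Graph n → ℕ → Set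
IsCliqueNumber G = IsGreatest (HasClique G)

HasProperColouring : ∀ {n} → Graph n → ℕ → Set
HasProperColouring {n} G r =
  Σ (Fin n → Fin r) (λ c → ∀ u v → adj G u v ≡ true → c u ≢ c v)

IsChromaticNumber : ∀ {n} → Graph n → ℕ → Set
IsChromaticNumber G = IsLeast (HasProperColouring G)

module Submission where

-- * φ⁽ᵏ⁾ ≤ φ⁽ᵏ⁺¹⁾ and φ⁽ᵏ⁾ ≤ φ: every δ_{k+1}-small set is δ_k-small (power
--   mean inequality D_k ≤ D_{k+1}) and every small set is δ_k-small, so each
--   partition witnessing the larger invariant also witnesses the smaller one.
--   The power mean step is derived, without roots, from the integer AM-GM
--   inequality (K+1)·m·d^K ≤ K·d^(K+1) + m^(K+1), summed over the class.
-- * φ ≤ ω: a greedy construction.  In a vertex set S pick u of maximum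
--   degree and split off the class W = {x ∈ S : x = u or x ≁ u}.  For v ∈ W,
--   d(v) + |W| ≤ d(u) + |W| ≤ n, since N(u) and W are disjoint; the rest of S
--   lies in N(u), so recursing on it yields small classes whose chosen
--   vertices u form a clique, one per class.
-- * ω ≤ χ: a proper colouring is injective on a clique.

open import Defs hiding (sym)
open import Data.Nat using (ℕ; zero; suc; _+_; _*_; _∸_; _^_; _≤_; _<_; z≤n; s≤s; s≤s⁻¹; _≟_)
open import Data.Nat.Properties
open import Data.Nat.Tactic.RingSolver using (solve-∀)
open import Data.Nat.ListAction using (sum)
open import Data.Fin using (Fin; zero; suc; toℕ; fromℕ<) renaming (_≟_ to _≟ᶠ_)
open import Data.Fin.Properties using (toℕ-injective; toℕ-fromℕ<; injective⇒≤)
open import Data.Bool using (Bool; true; false; if_then_else_; _∧_; _∨_; not)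
open import Data.Bool.Properties using (∧-zeroʳ)
open import Data.List.Properties using (map-tabulate)
open import Data.Product using (Σ; _×_; _,_; proj₁; proj₂)
open import Data.Sum using (_⊎_; inj₁; inj₂)
open import Function.Bundles using (mk⇔)
open import Function.Definitions using (Injective)
open import Relation.Nullary using (yes; no; does; contradiction)
open import Relation.Nullary.Decidable using (does-⇔)
open import Relation.Binary.PropositionalEquality
  using (_≡_; _≢_; refl; sym; trans; cong; cong₂; subst; subst₂; module ≡-Reasoning)

ind : Bool → ℕ
ind b = if b then 1 else 0

ind≤1 : ∀ b → ind b ≤ 1
ind≤1 true  = ≤-refl
ind≤1 false = z≤n

Σᵥ-suc : ∀ {n} (f : Fin (suc n) → ℕ) → Σᵥ f ≡ f zero + Σᵥ (λ x → f (suc x))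
Σᵥ-suc {n} f = cong (f zero +_) (cong sum
  (trans (map-tabulate suc f) (sym (map-tabulate (λ x → x) (λ x → f (suc x))))))

Σᵥ-cong : ∀ {n} {f g : Fin n → ℕ} → (∀ x → f x ≡ g x) → Σᵥ f ≡ Σᵥ g
Σᵥ-cong {zero}  _ = refl
Σᵥ-cong {suc n} {f} {g} f≡g rewrite Σᵥ-suc f | Σᵥ-suc g =
  cong₂ _+_ (f≡g zero) (Σᵥ-cong (λ x → f≡g (suc x)))

Σᵥ-mono : ∀ {n} {f g : Fin n → ℕ} → (∀ x → f x ≤ g x) → Σᵥ f ≤ Σᵥ g
Σᵥ-mono {zero}  _ = z≤n
Σᵥ-mono {suc n} {f} {g} f≤g rewrite Σᵥ-suc f | Σᵥ-suc g =
  +-mono-≤ (f≤g zero) (Σᵥ-mono (λ x → f≤g (suc x)))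

Σᵥ-mono-< : ∀ {n} {f g : Fin n → ℕ} → (∀ x → f x ≤ g x) →
            ∀ u → f u < g u → Σᵥ f < Σᵥ g
Σᵥ-mono-< {suc n} {f} {g} f≤g u fu<gu rewrite Σᵥ-suc f | Σᵥ-suc g with u
... | zero   = +-mono-<-≤ fu<gu (Σᵥ-mono (λ x → f≤g (suc x)))
... | suc u′ = +-mono-≤-< (f≤g zero) (Σᵥ-mono-< (λ x → f≤g (suc x)) u′ fu<gu)

Σᵥ-+ : ∀ {n} (f g : Fin n → ℕ) → Σᵥ (λ x → f x + g x) ≡ Σᵥ f + Σᵥ g
Σᵥ-+ {zero}  f g = refl
Σᵥ-+ {suc n} f g
  rewrite Σᵥ-suc (λ x → f x + g x) | Σᵥ-suc f | Σᵥ-suc g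
        | Σᵥ-+ (λ x → f (suc x)) (λ x → g (suc x)) =
  interchange (f zero) (g zero) _ _
  where
  interchange : ∀ a b c d → a + b + (c + d) ≡ a + c + (b + d)
  interchange = solve-∀

Σᵥ-*ʳ : ∀ {n} (f : Fin n → ℕ) a → Σᵥ (λ x → f x * a) ≡ Σᵥ f * a
Σᵥ-*ʳ {zero}  f a = refl
Σᵥ-*ʳ {suc n} f a rewrite Σᵥ-suc (λ x → f x * a) | Σᵥ-suc f =
  trans (cong (f zero * a +_) (Σᵥ-*ʳ (λ x → f (suc x)) a))
        (sym (*-distribʳ-+ a (f zero) _))

Σᵥ-≤1 : ∀ {n} {f : Fin n → ℕ} → (∀ x → f x ≤ 1) → Σᵥ f ≤ n
Σᵥ-≤1 {zero}  _ = z≤n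
Σᵥ-≤1 {suc n} {f} f≤1 rewrite Σᵥ-suc f =
  +-mono-≤ (f≤1 zero) (Σᵥ-≤1 (λ x → f≤1 (suc x)))

-- The size of a vertex set P and the sum of d(v)^K over P, for arbitrary
-- vertex weights d.  For P a class and d = deg these are exactly
-- classSize and classDegPow.
count : ∀ {n} → (Fin n → Bool) → ℕ
count P = Σᵥ (λ v → ind (P v))

powSum : ∀ {n} → (Fin n → Bool) → (Fin n → ℕ) → ℕ → ℕ
powSum P d K = Σᵥ (λ v → if P v then d v ^ K else 0)

-- 2md ≤ m² + d², first for m ≤ d (write d = m + e), then in general by symmetry.
2md≤m²+d²-ordered : ∀ m d → m ≤ d → 2 * (m * d) ≤ m * m + d * d
2md≤m²+d²-ordered m d m≤d =
  subst (λ d → 2 * (m * d) ≤ m * m + d * d) (m+[n∸m]≡n m≤d)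
        (subst (2 * (m * (m + (d ∸ m))) ≤_) (sym (square m (d ∸ m)))
               (m≤m+n _ ((d ∸ m) * (d ∸ m))))
  where
  square : ∀ m e → m * m + (m + e) * (m + e) ≡ 2 * (m * (m + e)) + e * e
  square = solve-∀

2md≤m²+d² : ∀ m d → 2 * (m * d) ≤ m * m + d * d
2md≤m²+d² m d with ≤-total m d
... | inj₁ m≤d = 2md≤m²+d²-ordered m d m≤d
... | inj₂ d≤m = subst₂ _≤_ (cong (2 *_) (*-comm d m)) (+-comm (d * d) (m * m))
                        (2md≤m²+d²-ordered d m d≤m)

-- Induction on K: adding K·m·d^(K+1) to the left side of the next case gives
-- (K+1)·d^K·2md; bound it using 2md ≤ m² + d² and then the induction
-- hypothesis, and cancel the added term again.
amgm : ∀ K m d → suc K * m * d ^ K ≤ K * d ^ suc K + m ^ suc K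
amgm zero m d = ≤-reflexive (base m)
  where
  base : ∀ m → 1 * m * 1 ≡ 0 + m * 1
  base = solve-∀
amgm (suc K) m d = +-cancelʳ-≤ (K * m * (d * x)) _ _ (begin
  suc (suc K) * m * (d * x) + K * m * (d * x) ≡⟨ regroup K m d x ⟩
  suc K * x * (2 * (m * d))                   ≤⟨ *-monoʳ-≤ (suc K * x) (2md≤m²+d² m d) ⟩
  suc K * x * (m * m + d * d)                 ≡⟨ expand K m d x ⟩
  m * (suc K * m * x) + suc K * (d * (d * x)) ≤⟨ +-monoˡ-≤ _ (*-monoʳ-≤ m (amgm K m d)) ⟩
  m * (K * (d * x) + m * m ^ K) + suc K * (d * (d * x))
    ≡⟨ collect K m d x (m ^ K) ⟩
  suc K * (d * (d * x)) + m * (m * m ^ K) + K * m * (d * x) ∎)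
  where
  open ≤-Reasoning
  x : ℕ
  x = d ^ K
  regroup : ∀ K m d x → suc (suc K) * m * (d * x) + K * m * (d * x) ≡ suc K * x * (2 * (m * d))
  regroup = solve-∀
  expand : ∀ K m d x → suc K * x * (m * m + d * d) ≡ m * (suc K * m * x) + suc K * (d * (d * x))
  expand = solve-∀
  collect : ∀ K m d x y → m * (K * (d * x) + m * y) + suc K * (d * (d * x))
                        ≡ suc K * (d * (d * x)) + m * (m * y) + K * m * (d * x)
  collect = solve-∀

pow-step : ∀ d K → d ^ suc K ≤ d ^ suc (suc K)
pow-step zero    K = z≤n
pow-step (suc d) K = m≤n*m _ (suc d)

-- Sum AM-GM (exponent K+1) over P and
-- cancel the factor (K+2)·m; for m = 0 all weights on P vanish.
powerMean-step : ∀ {n} (P : Fin n → Bool) (d : Fin n → ℕ) K m →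
  powSum P d (suc (suc K)) ≤ count P * m ^ suc (suc K) →
  powSum P d (suc K) ≤ count P * m ^ suc K
powerMean-step P d K zero h = ≤-trans (Σᵥ-mono pointwise) h
  where
  pointwise : ∀ v → (if P v then d v ^ suc K else 0) ≤ (if P v then d v ^ suc (suc K) else 0)
  pointwise v with P v
  ... | true  = pow-step (d v) K
  ... | false = z≤n
powerMean-step {n} P d K (suc m′) h = *-cancelʳ-≤ A (s * m ^ K′) (suc K′ * m) (begin
  A * (suc K′ * m)                                      ≡⟨ sym (Σᵥ-*ʳ (term K′) _) ⟩
  Σᵥ (λ v → term K′ v * (suc K′ * m))                    ≤⟨ Σᵥ-mono pointwise ⟩
  Σᵥ (λ v → term (suc K′) v * K′ + ind (P v) * m ^ suc K′) ≡⟨ split ⟩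
  B * K′ + s * m ^ suc K′                               ≤⟨ +-monoˡ-≤ _ (*-monoˡ-≤ K′ h) ⟩
  s * m ^ suc K′ * K′ + s * m ^ suc K′                   ≡⟨ factor s m (m ^ K′) K′ ⟩
  s * m ^ K′ * (suc K′ * m)                              ∎)
  where
  open ≤-Reasoning
  m K′ s : ℕ
  m  = suc m′
  K′ = suc K
  s  = count P
  term : ℕ → Fin n → ℕ
  term e v = if P v then d v ^ e else 0
  A B : ℕ
  A = powSum P d K′
  B = powSum P d (suc K′)
  split : Σᵥ (λ v → term (suc K′) v * K′ + ind (P v) * m ^ suc K′) ≡ B * K′ + s * m ^ suc K′
  split = trans (Σᵥ-+ (λ v → term (suc K′) v * K′) (λ v → ind (P v) * m ^ suc K′))
                (cong₂ _+_ (Σᵥ-*ʳ (term (suc K′)) K′) (Σᵥ-*ʳ (λ v → ind (P v)) (m ^ suc K′)))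
  rearrange : ∀ K m d x y → suc K * m * x ≤ K * (d * x) + m * y →
              x * (suc K * m) ≤ d * x * K + 1 * (m * y)
  rearrange K m d x y = subst₂ _≤_ (lhs K m x) (rhs K m d x y)
    where
    lhs : ∀ K m x → suc K * m * x ≡ x * (suc K * m)
    lhs = solve-∀
    rhs : ∀ K m d x y → K * (d * x) + m * y ≡ d * x * K + 1 * (m * y)
    rhs = solve-∀
  pointwise : ∀ v → term K′ v * (suc K′ * m) ≤ term (suc K′) v * K′ + ind (P v) * m ^ suc K′
  pointwise v with P v
  ... | true  = rearrange K′ m (d v) (d v ^ K′) (m ^ K′) (amgm K′ m (d v))
  ... | false = z≤n
  factor : ∀ s m y K → s * (m * y) * K + s * (m * y) ≡ s * y * (suc K * m)
  factor = solve-∀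

powSum-bounded : ∀ {n} (P : Fin n → Bool) (d : Fin n → ℕ) K m →
  (∀ v → P v ≡ true → d v ≤ m) → powSum P d K ≤ count P * m ^ K
powSum-bounded P d K m d≤m =
  ≤-trans (Σᵥ-mono pointwise) (≤-reflexive (Σᵥ-*ʳ (λ v → ind (P v)) (m ^ K)))
  where
  pointwise : ∀ v → (if P v then d v ^ K else 0) ≤ ind (P v) * m ^ K
  pointwise v with P v in Pv
  ... | true  = subst (d v ^ K ≤_) (sym (+-identityʳ _)) (^-monoˡ-≤ K (d≤m v Pv))
  ... | false = z≤n

argmaxOn : ∀ {n} (S : Fin n → Bool) (f : Fin n → ℕ) →
  (∀ v → S v ≡ false) ⊎ Σ (Fin n) (λ u → S u ≡ true × (∀ v → S v ≡ true → f v ≤ f u))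
argmaxOn {zero} S f = inj₁ (λ ())
argmaxOn {suc n} S f with argmaxOn (λ x → S (suc x)) (λ x → f (suc x)) | S zero in S0
... | inj₁ none | false = inj₁ λ { zero → S0 ; (suc v) → none v }
... | inj₁ none | true  = inj₂ (zero , S0 , λ
  { zero _ → ≤-refl
  ; (suc v) Sv → contradiction (trans (sym Sv) (none v)) λ () })
... | inj₂ (u , Su , max) | false = inj₂ (suc u , Su , λ
  { zero Sz → contradiction (trans (sym Sz) S0) λ ()
  ; (suc v) Sv → max v Sv })
... | inj₂ (u , Su , max) | true with f zero ≤? f (suc u)
...   | yes f0≤ = inj₂ (suc u , Su , λ { zero _ → f0≤ ; (suc v) Sv → max v Sv })
...   | no f0≰  = inj₂ (zero , S0 , λ
  { zero _ → ≤-refl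
  ; (suc v) Sv → ≤-trans (max v Sv) (≰⇒≥ f0≰) })

∧-not-true : ∀ a b → a ∧ not b ≡ true → a ≡ true × b ≡ false
∧-not-true true false _ = refl , refl

∨-not-false : ∀ a b → a ∨ not b ≡ false → b ≡ true
∨-not-false false true _ = refl

-- Vertices with pairwise adjacent images are distinct, as G is loopless.
pairwiseAdjacent⇒injective : ∀ {n m} (G : Graph n) (f : Fin m → Fin n) →
  (∀ i j → i ≢ j → adj G (f i) (f j) ≡ true) → Injective _≡_ _≡_ f
pairwiseAdjacent⇒injective G f adjacent {i} {j} fi≡fj with i ≟ᶠ j
... | yes i≡j = i≡j
... | no  i≢j = contradiction
  (trans (sym (adjacent i j i≢j)) (trans (cong (λ x → adj G x (f j)) fi≡fj) (irrfl G (f j))))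
  λ ()

module Greedy {n : ℕ} (G : Graph n) where

  -- x is u itself or a non-neighbour of u; W = S ∧ far u is the class split off.
  far : Fin n → Fin n → Bool
  far u x = does (x ≟ᶠ u) ∨ not (adj G u x)

  far-self : ∀ u → far u u ≡ true
  far-self u with u ≟ᶠ u
  ... | yes _   = refl
  ... | no  u≢u = contradiction refl u≢u

  -- N(u) and {x ∈ S : far u x} are disjoint, hence d(u) + |W| ≤ n.
  deg+far≤n : ∀ (S : Fin n → Bool) u → deg G u + count (λ x → S x ∧ far u x) ≤ n
  deg+far≤n S u = ≤-trans (≤-reflexive (sym (Σᵥ-+ (λ x → ind (adj G u x)) _))) (Σᵥ-≤1 disjoint)
    where
    disjoint : ∀ x → ind (adj G u x) + ind (S x ∧ (does (x ≟ᶠ u) ∨ not (adj G u x))) ≤ 1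
    disjoint x with adj G u x in ux | x ≟ᶠ u
    ... | false | _        = ind≤1 _
    ... | true  | yes refl = contradiction (trans (sym ux) (irrfl G x)) λ ()
    ... | true  | no  _    = ≤-reflexive (cong (λ b → suc (ind b)) (∧-zeroʳ (S x)))

  labelCount : (Fin n → Bool) → (Fin n → ℕ) → ℕ → ℕ
  labelCount S label j = count (λ x → S x ∧ does (label x ≟ j))

  -- A partition of S into small classes, indexed by labels 0 … size-1, with
  -- a clique picking one vertex from each class.
  record CliquePartition (S : Fin n → Bool) : Set where
    field
      size        : ℕ
      apex        : Fin size → Fin n
      label       : Fin n → ℕ
      apex∈S      : ∀ i → S (apex i) ≡ true
      apex-adj    : ∀ i j → i ≢ j → adj G (apex i) (apex j) ≡ true
      label-apex  : ∀ i → label (apex i) ≡ toℕ i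
      label<size  : ∀ v → S v ≡ true → label v < size
      class-small : ∀ v → S v ≡ true → deg G v + labelCount S label (label v) ≤ n

  emptyPartition : ∀ S → (∀ v → S v ≡ false) → CliquePartition S
  emptyPartition S none = record
    { size = 0 ; apex = λ () ; label = λ _ → 0 ; apex∈S = λ () ; apex-adj = λ ()
    ; label-apex = λ () ; label<size = λ v Sv → absurd v Sv ; class-small = λ v Sv → absurd v Sv }
    where
    absurd : ∀ {A : Set} v → S v ≡ true → A
    absurd v Sv = contradiction (trans (sym Sv) (none v)) λ ()

  rest : (Fin n → Bool) → Fin n → Fin n → Bool
  rest S u x = S x ∧ not (far u x)

  -- Removing the class of u ∈ S strictly shrinks S, so the recursion ends.
  rest-smaller : ∀ S u → S u ≡ true → count (rest S u) < count S
  rest-smaller S u Su = Σᵥ-mono-< below u strict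
    where
    below : ∀ x → ind (S x ∧ not (far u x)) ≤ ind (S x)
    below x with S x
    ... | true  = ind≤1 _
    ... | false = z≤n
    strict : ind (S u ∧ not (far u u)) < ind (S u)
    strict rewrite Su | far-self u = s≤s z≤n

  relabel : Bool → ℕ → ℕ
  relabel true  _ = 0
  relabel false l = suc l

  count-new : ∀ S u (label : Fin n → ℕ) →
    labelCount S (λ x → relabel (far u x) (label x)) 0 ≡ count (λ x → S x ∧ far u x)
  count-new S u label = Σᵥ-cong pointwise
    where
    pointwise : ∀ x → ind (S x ∧ does (relabel (far u x) (label x) ≟ 0)) ≡ ind (S x ∧ far u x)
    pointwise x with S x | far u x
    ... | false | _     = refl
    ... | true  | true  = refl
    ... | true  | false = refl

  count-shifted : ∀ S u (label : Fin n → ℕ) j →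
    labelCount S (λ x → relabel (far u x) (label x)) (suc j) ≡ labelCount (rest S u) label j
  count-shifted S u label j = Σᵥ-cong pointwise
    where
    pointwise : ∀ x → ind (S x ∧ does (relabel (far u x) (label x) ≟ suc j))
                    ≡ ind ((S x ∧ not (far u x)) ∧ does (label x ≟ j))
    pointwise x with S x | far u x
    ... | false | _     = refl
    ... | true  | true  = refl
    ... | true  | false = refl

  extend : ∀ S u → S u ≡ true → (∀ v → S v ≡ true → deg G v ≤ deg G u) →
           CliquePartition (rest S u) → CliquePartition S
  extend S u Su u-max P = record
    { size = suc size ; apex = apex′ ; label = label′ ; apex∈S = apex′∈S ; apex-adj = apex′-adj
    ; label-apex = label′-apex ; label<size = label′<size ; class-small = class′-small }
    where
    open CliquePartition P

    label′ : Fin n → ℕ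
    label′ x = relabel (far u x) (label x)

    apex′ : Fin (suc size) → Fin n
    apex′ zero    = u
    apex′ (suc i) = apex i

    apex-near : ∀ i → S (apex i) ≡ true × far u (apex i) ≡ false
    apex-near i = ∧-not-true _ _ (apex∈S i)

    apex′∈S : ∀ i → S (apex′ i) ≡ true
    apex′∈S zero    = Su
    apex′∈S (suc i) = proj₁ (apex-near i)

    u-adj : ∀ i → adj G u (apex i) ≡ true
    u-adj i = ∨-not-false _ _ (proj₂ (apex-near i))

    apex′-adj : ∀ i j → i ≢ j → adj G (apex′ i) (apex′ j) ≡ true
    apex′-adj zero    zero    i≢j = contradiction refl i≢j
    apex′-adj zero    (suc j) _   = u-adj j
    apex′-adj (suc i) zero    _   = trans (Defs.sym G (apex i) u) (u-adj i)
    apex′-adj (suc i) (suc j) i≢j = apex-adj i j (λ i≡j → i≢j (cong suc i≡j))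

    label′-apex : ∀ i → label′ (apex′ i) ≡ toℕ i
    label′-apex zero    = cong (λ b → relabel b (label u)) (far-self u)
    label′-apex (suc i) = trans (cong (λ b → relabel b (label (apex i))) (proj₂ (apex-near i)))
                                (cong suc (label-apex i))

    label′<size : ∀ v → S v ≡ true → relabel (far u v) (label v) < suc size
    label′<size v Sv with far u v in uv
    ... | true  = s≤s z≤n
    ... | false = s≤s (label<size v (cong₂ (λ a b → a ∧ not b) Sv uv))

    class′-small : ∀ v → S v ≡ true →
      deg G v + labelCount S label′ (relabel (far u v) (label v)) ≤ n
    class′-small v Sv with far u v in uv
    ... | true  = ≤-trans (≤-reflexive (cong (deg G v +_) (count-new S u label)))
                          (≤-trans (+-monoˡ-≤ _ (u-max v Sv)) (deg+far≤n S u))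
    ... | false = subst (λ c → deg G v + c ≤ n) (sym (count-shifted S u label (label v)))
                        (class-small v (cong₂ (λ a b → a ∧ not b) Sv uv))

  cliquePartition : ∀ fuel S → count S < fuel → CliquePartition S
  cliquePartition (suc fuel) S |S|<fuel with argmaxOn S (deg G)
  ... | inj₁ none = emptyPartition S none
  ... | inj₂ (u , Su , u-max) = extend S u Su u-max
    (cliquePartition fuel (rest S u) (≤-trans (rest-smaller S u Su) (s≤s⁻¹ |S|<fuel)))

  smallPartitionWithClique : Σ ℕ (λ r → SmallPartition G r × HasClique G r)
  smallPartitionWithClique =
    size , ((classOf , surjective) , small) , apex , pairwiseAdjacent⇒injective G apex apex-adj , apex-adj
    where
    open CliquePartition (cliquePartition (suc n) (λ _ → true) (s≤s (Σᵥ-≤1 (λ _ → ≤-refl))))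

    classOf : Fin n → Fin size
    classOf v = fromℕ< (label<size v refl)

    toℕ-classOf : ∀ v → toℕ (classOf v) ≡ label v
    toℕ-classOf v = toℕ-fromℕ< _

    surjective : ∀ i → Σ (Fin n) (λ x → ∀ {z} → z ≡ x → classOf z ≡ i)
    surjective i = apex i , λ { refl → toℕ-injective (trans (toℕ-classOf (apex i)) (label-apex i)) }

    sameClass : ∀ x v → does (classOf x ≟ᶠ classOf v) ≡ does (label x ≟ label v)
    sameClass x v = does-⇔ (mk⇔
      (λ eq → trans (sym (toℕ-classOf x)) (trans (cong toℕ eq) (toℕ-classOf v)))
      (λ eq → toℕ-injective (trans (toℕ-classOf x) (trans eq (sym (toℕ-classOf v))))))
      (classOf x ≟ᶠ classOf v) (label x ≟ label v)

    small : ∀ i → IsSmallClass G classOf i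
    small _ v refl = m+n≤o⇒m≤o∸n (deg G v)
      (subst (λ c → deg G v + c ≤ n) (Σᵥ-cong (λ x → cong ind (sym (sameClass x v))))
             (class-small v refl))

inClass-true : ∀ {n r} (c : Fin n → Fin r) i v → does (c v ≟ᶠ i) ≡ true → c v ≡ i
inClass-true c i v inClass with c v ≟ᶠ i
... | yes cv≡i = cv≡i
... | no  _    = contradiction inClass λ ()

deltaPartition-step : ∀ {n} (G : Graph n) k r →
  DeltaSmallPartition G (suc (suc k)) r → DeltaSmallPartition G (suc k) r
deltaPartition-step {n} G k r ((c , c-surj) , δ-small) =
  (c , c-surj) , λ i → powerMean-step (inClass c i) (deg G) k (n ∸ classSize c i) (δ-small i)

smallPartition⇒delta : ∀ {n} (G : Graph n) k r → SmallPartition G r → DeltaSmallPartition G k r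
smallPartition⇒delta {n} G k r ((c , c-surj) , small) =
  (c , c-surj) , λ i → powSum-bounded (inClass c i) (deg G) k (n ∸ classSize c i)
                         (λ v v∈i → small i v (inClass-true c i v v∈i))

clique≤colouring : ∀ {n} (G : Graph n) {w x} → HasClique G w → HasProperColouring G x → w ≤ x
clique≤colouring G (f , _ , adjacent) (colour , proper) = injective⇒≤ {f = λ i → colour (f i)} distinct
  where
  distinct : ∀ {i j} → colour (f i) ≡ colour (f j) → i ≡ j
  distinct {i} {j} same with i ≟ᶠ j
  ... | yes i≡j = i≡j
  ... | no  i≢j = contradiction same (proper (f i) (f j) (adjacent i j i≢j))

least-mono : ∀ {P Q : ℕ → Set} {a b} → (∀ r → P r → Q r) → IsLeast Q a → IsLeast P b → a ≤ b
least-mono P⇒Q (_ , a-least) (Pb , _) = a-least _ (P⇒Q _ Pb)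

proposition1p4 : ∀ {n} (G : Graph n) →
    (∀ k a b → IsPhiK G (suc k) a → IsPhiK G (suc (suc k)) b → a ≤ b) ×
    (∀ k a p → IsPhiK G (suc k) a → IsPhi G p → a ≤ p) ×
    (∀ p w → IsPhi G p → IsCliqueNumber G w → p ≤ w) ×
    (∀ w x → IsCliqueNumber G w → IsChromaticNumber G x → w ≤ x)
proposition1p4 G =
  (λ k a b φᵏa φᵏ⁺¹b → least-mono (deltaPartition-step G k) φᵏa φᵏ⁺¹b) ,
  (λ k a p φᵏa φp → least-mono (smallPartition⇒delta G (suc k)) φᵏa φp) ,
  (λ p w φp ωw → φ≤ω φp ωw) ,
  (λ w x ωw χx → clique≤colouring G (proj₁ ωw) (proj₁ χx))
  where
  φ≤ω : ∀ {p w} → IsPhi G p → IsCliqueNumber G w → p ≤ w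
  φ≤ω (_ , p-least) (_ , w-greatest) with Greedy.smallPartitionWithClique G
  ... | r , small , clique = ≤-trans (p-least r small) (w-greatest r clique)
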